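{- Let $S$ be a solid and let $x\in S$ with $x\ne e(x)$. Then (1) $u(x)e(x)=x\,e(u(x))=e(x)$; (2) $e(x^{ -1})=e(x)x^{ -1}x^{ -1}$.
   Context: A solid is a set $S$ with binary operations $+$ and $\cdot$ and a relation $\le$ satisfying: (1) $+$ is associative and commutative; for every $x$ there is a unique $e$ with $x+e=x$ and $e+f=e$ whenever $x+f=x$, written $e(x)$ (the magnitude of $x$); for every $x$ there is $s$ with $x+s=e(x)$ and $e(s)=e(x)$, written $-x$; $e(x+y)=e(x)$ or $e(x+y)=e(y)$. (2) $\cdot$ is associative and commutative; for every $x\ne e(x)$ there is a unique $u$ with $xu=x$ and $uv=u$ whenever $xv=x$, written $u(x)$; for every $x\ne e(x)$ there is $d$ with $xd=u(x)$ and $u(d)=u(x)$, written $x^{ -1}$; for $x\ne e(x),y\ne e(y)$: $u(xy)=u(x)$ or $u(xy)=u(y)$. (3) $\le$ is a total order; $x\le y\Rightarrow x+z\le y+z$; $y+e(x)=e(x)\Rightarrow (y\le e(x)$ and $-y\le e(x))$; $(e(x)<x$ and $y\le z)\Rightarrow xy\le xz$; $e(y)\le y\le z\Rightarrow e(x)y\le e(x)z$. (4) For all $x,y$ there is $z$ with $e(x)y=e(z)$; $e(xy)=e(x)y+e(y)x$; for $x\ne e(x)$, $e(u(x))=e(x)x^{ -1}$; $xy+xz=x(y+z)+e(x)y+e(x)z$; $-(xy)=(-x)y$. (5) There is $0$ with $0+x=x$ for all $x$; there is $1$ with $1x=x$ for all $x$; there is $M$ with $e(x)+M=M$ for all $x$;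 there is $x$ with $e(x)\ne 0$ and $e(x)\ne M$; for every $x$ there is $a$ with $x=a+e(x)$ and $e(a)=0$; if $x=e(x)$, $y=e(y)$ and $x<y$ then there is $z\ne e(z)$ with $x<z<y$. -}

module Defs where

open import Level using (Level; suc; _⊔_)
open import Relation.Binary.PropositionalEquality using (_≡_; _≢_)
open import Relation.Binary.Structures using (IsTotalOrder)
open import Data.Product using (Σ; _×_; ∃; ∃-syntax)
open import Data.Sum using (_⊎_)

-- The magnitude e(x), the neutrix-unit u(x), the opposite -x and the
-- inverse x⁻¹ are given as operations together with their defining
-- properties (existence of a witness = a choice function).
-- u and _⁻¹ are total functions whose properties are only required
-- for x ≢ e x (their values elsewhere are irrelevant).
record Solid (a ℓ : Level) : Set (suc (a ⊔ ℓ)) where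
  infixl 6 _+_
  infixl 7 _·_
  infix 4 _≤_ _<_
  field
    S      : Set a
    _+_    : S → S → S
    _·_    : S → S → S
    _≤_    : S → S → Set ℓ
    e      : S → S
    -_     : S → S
    u      : S → S
    _⁻¹    : S → S
    𝟘 𝟙 M  : S

  _<_ : S → S → Set (a ⊔ ℓ)
  x < y = (x ≤ y) × (x ≢ y)

  field
    +-assoc  : ∀ x y z → (x + y) + z ≡ x + (y + z)
    +-comm   : ∀ x y → x + y ≡ y + x
    e-neut   : ∀ x → x + e x ≡ x
    e-min    : ∀ x f → x + f ≡ x → e x + f ≡ e x
    e-unique : ∀ x e′ → x + e′ ≡ x → (∀ f → x + f ≡ x → e′ + f ≡ e′) → e′ ≡ e x
    neg-inv  : ∀ x → x + (- x) ≡ e x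
    neg-e    : ∀ x → e (- x) ≡ e x
    e-+      : ∀ x y → (e (x + y) ≡ e x) ⊎ (e (x + y) ≡ e y)
    ·-assoc  : ∀ x y z → (x · y) · z ≡ x · (y · z)
    ·-comm   : ∀ x y → x · y ≡ y · x
    u-neut   : ∀ x → x ≢ e x → x · u x ≡ x
    u-min    : ∀ x → x ≢ e x → ∀ v → x · v ≡ x → u x · v ≡ u x
    u-unique : ∀ x → x ≢ e x → ∀ u′ → x · u′ ≡ x → (∀ v → x · v ≡ x → u′ · v ≡ u′) → u′ ≡ u x
    inv-inv  : ∀ x → x ≢ e x → x · (x ⁻¹) ≡ u x
    inv-u    : ∀ x → x ≢ e x → u (x ⁻¹) ≡ u x
    u-·      : ∀ x y → x ≢ e x → y ≢ e y → (u (x · y) ≡ u x) ⊎ (u (x · y) ≡ u y)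
    ≤-isTotalOrder : IsTotalOrder _≡_ _≤_
    ≤-+      : ∀ x y z → x ≤ y → x + z ≤ y + z
    ≤-e      : ∀ x y → y + e x ≡ e x → (y ≤ e x) × (- y ≤ e x)
    ≤-·      : ∀ x y z → e x < x → y ≤ z → x · y ≤ x · z
    ≤-e·     : ∀ x y z → e y ≤ y → y ≤ z → e x · y ≤ e x · z
    e·-is-e  : ∀ x y → ∃[ z ] (e x · y ≡ e z)
    e-·      : ∀ x y → e (x · y) ≡ e x · y + e y · x
    e-u      : ∀ x → x ≢ e x → e (u x) ≡ e x · (x ⁻¹)
    distrib  : ∀ x y z → x · y + x · z ≡ x · (y + z) + e x · y + e x · z
    neg-·    : ∀ x y → - (x · y) ≡ (- x) · y
    𝟘-id     : ∀ x → 𝟘 + x ≡ x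
    𝟙-id     : ∀ x → 𝟙 · x ≡ x
    M-max    : ∀ x → e x + M ≡ M
    nontriv  : ∃[ x ] (e x ≢ 𝟘 × e x ≢ M)
    decomp   : ∀ x → ∃[ a ] (x ≡ a + e x × e a ≡ 𝟘)
    dense    : ∀ x y → x ≡ e x → y ≡ e y → x < y → ∃[ z ] (z ≢ e z × x < z × z < y)

-- Both parts rest on e(u x) = e(x)·x⁻¹: multiplying by x gives x·e(u x) = e(x)·u(x),
-- and e(x) = e(x·u x) = e(x)·u(x) + e(u x)·x = 2·(e(x)·u(x)) is a magnitude added to
-- itself, hence e(x)·u(x) = e(x).  Part (2) applies this to x⁻¹, which is legitimate
-- because x⁻¹ is not a magnitude: otherwise u(x) = x·x⁻¹ and then x = x·u(x) would be
-- multiples of magnitudes, hence magnitudes.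
module Submission where

open import Defs
open import Relation.Binary.PropositionalEquality
  using (_≡_; _≢_; sym; trans; cong; cong₂; module ≡-Reasoning)
open import Data.Product using (_×_; _,_)

module SolidProperties {a ℓ} (Sol : Solid a ℓ) where
  open Solid Sol
  open ≡-Reasoning

  e-+-idem : ∀ w → e w + e w ≡ e w
  e-+-idem w = e-min w (e w) (e-neut w)

  e-idem : ∀ w → e (e w) ≡ e w
  e-idem w = sym (e-unique (e w) (e w) (e-+-idem w) (λ _ h → h))

  e·-magnitude : ∀ z y → e z · y ≡ e (e z · y)
  e·-magnitude z y with e·-is-e z y
  ... | w , eq = trans eq (trans (sym (e-idem w)) (cong e (sym eq)))

  ≡e·⇒magnitude : ∀ {x} z y → x ≡ e z · y → x ≡ e x
  ≡e·⇒magnitude z y x≡ = trans x≡ (trans (e·-magnitude z y) (cong e (sym x≡)))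

  ·e-u : ∀ x → x ≢ e x → x · e (u x) ≡ e x · u x
  ·e-u x x≢ex = begin
    x · e (u x)        ≡⟨ cong (x ·_) (e-u x x≢ex) ⟩
    x · (e x · x ⁻¹)   ≡⟨ sym (·-assoc x (e x) (x ⁻¹)) ⟩
    (x · e x) · x ⁻¹   ≡⟨ cong (_· x ⁻¹) (·-comm x (e x)) ⟩
    (e x · x) · x ⁻¹   ≡⟨ ·-assoc (e x) x (x ⁻¹) ⟩
    e x · (x · x ⁻¹)   ≡⟨ cong (e x ·_) (inv-inv x x≢ex) ⟩
    e x · u x          ∎

  e·u : ∀ x → x ≢ e x → e x · u x ≡ e x
  e·u x x≢ex with e·-is-e x (u x)
  ... | w , eq = sym (begin
    e x                          ≡⟨ cong e (sym (u-neut x x≢ex)) ⟩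
    e (x · u x)                  ≡⟨ e-· x (u x) ⟩
    e x · u x + e (u x) · x      ≡⟨ cong (e x · u x +_) (trans (·-comm (e (u x)) x) (·e-u x x≢ex)) ⟩
    e x · u x + e x · u x        ≡⟨ cong₂ _+_ eq eq ⟩
    e w + e w                    ≡⟨ e-+-idem w ⟩
    e w                          ≡⟨ sym eq ⟩
    e x · u x                    ∎)

  e-u·≡e : ∀ x → x ≢ e x → e (u x) · x ≡ e x
  e-u·≡e x x≢ex = begin
    e (u x) · x          ≡⟨ cong (_· x) (e-u x x≢ex) ⟩
    (e x · x ⁻¹) · x     ≡⟨ ·-assoc (e x) (x ⁻¹) x ⟩
    e x · (x ⁻¹ · x)     ≡⟨ cong (e x ·_) (trans (·-comm (x ⁻¹) x) (inv-inv x x≢ex)) ⟩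
    e x · u x            ≡⟨ e·u x x≢ex ⟩
    e x                  ∎

  ⁻¹-nonMagnitude : ∀ x → x ≢ e x → x ⁻¹ ≢ e (x ⁻¹)
  ⁻¹-nonMagnitude x x≢ex x⁻¹≡e = x≢ex (≡e·⇒magnitude (u x) x x≡)
    where
    u≡ : u x ≡ e (x ⁻¹) · x
    u≡ = trans (sym (inv-inv x x≢ex)) (trans (cong (x ·_) x⁻¹≡e) (·-comm x (e (x ⁻¹))))

    x≡ : x ≡ e (u x) · x
    x≡ = begin
      x           ≡⟨ sym (u-neut x x≢ex) ⟩
      x · u x     ≡⟨ ·-comm x (u x) ⟩
      u x · x     ≡⟨ cong (_· x) (≡e·⇒magnitude (x ⁻¹) x u≡) ⟩
      e (u x) · x ∎

  e-⁻¹ : ∀ x → x ≢ e x → e (x ⁻¹) ≡ e x · x ⁻¹ · x ⁻¹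
  e-⁻¹ x x≢ex = sym (begin
    e x · x ⁻¹ · x ⁻¹       ≡⟨ cong (_· x ⁻¹) (sym (e-u x x≢ex)) ⟩
    e (u x) · x ⁻¹          ≡⟨ cong (λ t → e t · x ⁻¹) (sym (inv-u x x≢ex)) ⟩
    e (u (x ⁻¹)) · x ⁻¹     ≡⟨ e-u·≡e (x ⁻¹) (⁻¹-nonMagnitude x x≢ex) ⟩
    e (x ⁻¹)                ∎)

theorem2p16 : ∀ {a ℓ} (Sol : Solid a ℓ) → let open Solid Sol in
    ∀ (x : S) → x ≢ e x →
      ((u x · e x ≡ x · e (u x)) × (x · e (u x) ≡ e x))
      × (e (x ⁻¹) ≡ e x · (x ⁻¹) · (x ⁻¹))
theorem2p16 Sol x x≢ex =
  ( trans (·-comm (u x) (e x)) (sym (·e-u x x≢ex))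
  , trans (·e-u x x≢ex) (e·u x x≢ex) )
  , e-⁻¹ x x≢ex
  where
  open Solid Sol
  open SolidProperties Sol
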